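{- For every $n\ge0$, the polynomial $B_n(q)$ has exactly $g(n)+1$ nonzero coefficients.
   Context: Johnson's $q$-Bell polynomials are defined by $B_0(q)=1$ and $B_n(q)=\sum_{k=0}^{n-1}\binom{n-1}{k}_qB_k(q)$ for $n\ge1$, where $\binom nk_q$ is the Gaussian ($q$-binomial) coefficient. The function $g:\mathbb N\to\mathbb N$ is defined by $g(0)=0$ and $g(n)=\max\{(k-1)(n-k)+g(n-k):1\le k\le n\}$ for $n\ge1$. -}

module Defs where

open import Data.Nat using (ℕ; zero; suc; _+_; _*_; _∸_; _⊔_)
open import Data.List using (List; []; _∷_; length; filter; reverse; zipWith; allFin)
open import Data.Fin using (Fin; toℕ)
open import Relation.Nullary using (¬_)
open import Relation.Nullary.Decidable using (¬?)
open import Data.Nat using (_≟_)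

-- Polynomials in q with natural-number coefficients, represented by
-- their coefficient lists: a₀ ∷ a₁ ∷ … means a₀ + a₁ q + …
-- (trailing zeros are allowed; they do not affect the count below).
Poly : Set
Poly = List ℕ

_⊕_ : Poly → Poly → Poly
[] ⊕ q = q
p ⊕ [] = p
(a ∷ p) ⊕ (b ∷ q) = (a + b) ∷ (p ⊕ q)

_·_ : ℕ → Poly → Poly
c · [] = []
c · (a ∷ p) = (c * a) ∷ (c · p)

shift : Poly → Poly
shift p = 0 ∷ p

shiftN : ℕ → Poly → Poly
shiftN zero p = p
shiftN (suc k) p = shift (shiftN k p)

_⊗_ : Poly → Poly → Poly
[] ⊗ q = []
(a ∷ p) ⊗ q = (a · q) ⊕ shift (p ⊗ q)

-- Gaussian (q-binomial) coefficient via the q-Pascal rule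
--   [n+1, k+1]_q = [n, k]_q + q^{k+1} [n, k+1]_q,  [n,0]_q = 1, [0,k+1]_q = 0
qbinom : ℕ → ℕ → Poly
qbinom n zero = 1 ∷ []
qbinom zero (suc k) = []
qbinom (suc n) (suc k) = qbinom n k ⊕ shiftN (suc k) (qbinom n (suc k))

sumTerms : ℕ → ℕ → List Poly → Poly
sumTerms m k [] = []
sumTerms m k (b ∷ bs) = (qbinom m k ⊗ b) ⊕ sumTerms m (suc k) bs

-- allB n = B_0 ∷ B_1 ∷ … ∷ B_n
-- B_{n+1} = Σ_{k=0}^{n} [n choose k]_q B_k
allB : ℕ → List Poly
allB zero = (1 ∷ []) ∷ []
allB (suc n) = let bs = allB n in appendLast bs (sumTerms n 0 bs)
  where
  appendLast : List Poly → Poly → List Poly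
  appendLast [] x = x ∷ []
  appendLast (y ∷ ys) x = y ∷ appendLast ys x

last : Poly → List Poly → Poly
last d [] = d
last d (x ∷ xs) = last x xs

qBell : ℕ → Poly
qBell n = last [] (allB n)

nonzeroCount : Poly → ℕ
nonzeroCount p = length (filter (λ a → ¬? (a ≟ 0)) p)

-- g(0) = 0, g(n) = max_{1≤k≤n} (k-1)(n-k) + g(n-k); defined via allG n = g(0) ∷ … ∷ g(n)
-- (reversed storage: revG n = g(n) ∷ g(n-1) ∷ … ∷ g(0))
-- maxOver n j rs, with rs = g(n-j) ∷ g(n-j-1) ∷ … ∷ g(0), computes max over k = j..n
maxOver : ℕ → ℕ → List ℕ → ℕ
maxOver n k [] = 0
maxOver n k (gv ∷ rest) = ((k ∸ 1) * (n ∸ k) + gv) ⊔ maxOver n (suc k) rest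

revG : ℕ → List ℕ
revG zero = 0 ∷ []
revG (suc n) = let rs = revG n in maxOver (suc n) 1 rs ∷ rs

g : ℕ → ℕ
g zero = 0
g (suc n) = maxOver (suc n) 1 (revG n)

-- Call a coefficient list gapless of degree d if its coefficients of
-- degree 0, …, d are positive and all later ones vanish; such a
-- polynomial has exactly d + 1 nonzero coefficients.  Gaplessness is
-- preserved by sums (degree ⊔) and products (degree +), and by the
-- q-Pascal rule [n, k]_q is gapless of degree k (n − k).  Hence
-- B_{n+1} = Σ_k [n, k]_q B_k is gapless of degree max_k k (n − k) + g(k),
-- which is the recurrence of g after the substitution k ↦ n + 1 − k.
module Submission where

open import Defs
open import Data.Nat using (ℕ; zero; suc; _+_; _*_; _∸_; _⊔_; _≤_; _<_; z≤n; s≤s)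
open import Data.Nat.Properties
open import Data.List using (List; []; _∷_; _∷ʳ_)
open import Data.List.Relation.Unary.All using (All; []; _∷_)
open import Function using (_∘_)
open import Relation.Binary.PropositionalEquality
  using (_≡_; refl; sym; trans; cong; cong₂; subst; module ≡-Reasoning)

IsZero : Poly → Set
IsZero = All (_≡ 0)

data Gapless : ℕ → Poly → Set where
  end  : ∀ {a zs} → IsZero zs → Gapless 0 (suc a ∷ zs)
  step : ∀ {a d p} → Gapless d p → Gapless (suc d) (suc a ∷ p)

nonzeroCount-isZero : ∀ {p} → IsZero p → nonzeroCount p ≡ 0
nonzeroCount-isZero []         = refl
nonzeroCount-isZero (refl ∷ z) = nonzeroCount-isZero z

nonzeroCount-gapless : ∀ {d p} → Gapless d p → nonzeroCount p ≡ suc d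
nonzeroCount-gapless (end z)  = cong suc (nonzeroCount-isZero z)
nonzeroCount-gapless (step s) = cong suc (nonzeroCount-gapless s)

gapless-degree : ∀ {d e p} → d ≡ e → Gapless d p → Gapless e p
gapless-degree refl s = s

isZero-⊕ : ∀ {p q} → IsZero p → IsZero q → IsZero (p ⊕ q)
isZero-⊕ []          zq          = zq
isZero-⊕ (zp₀ ∷ zp)  []          = zp₀ ∷ zp
isZero-⊕ (refl ∷ zp) (refl ∷ zq) = refl ∷ isZero-⊕ zp zq

gapless-⊕-isZero : ∀ {d p q} → Gapless d p → IsZero q → Gapless d (p ⊕ q)
gapless-⊕-isZero (end zp)  []          = end zp
gapless-⊕-isZero (end zp)  (refl ∷ zq) = end (isZero-⊕ zp zq)
gapless-⊕-isZero (step s)  []          = step s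
gapless-⊕-isZero (step s)  (refl ∷ zq) = step (gapless-⊕-isZero s zq)

isZero-⊕-gapless : ∀ {d p q} → IsZero p → Gapless d q → Gapless d (p ⊕ q)
isZero-⊕-gapless []          s        = s
isZero-⊕-gapless (refl ∷ zp) (end zq) = end (isZero-⊕ zp zq)
isZero-⊕-gapless (refl ∷ zp) (step s) = step (isZero-⊕-gapless zp s)

gapless-⊕ : ∀ {d e p q} → Gapless d p → Gapless e q → Gapless (d ⊔ e) (p ⊕ q)
gapless-⊕ (end zp)  (end zq)  = end (isZero-⊕ zp zq)
gapless-⊕ (end zp)  (step t)  = step (isZero-⊕-gapless zp t)
gapless-⊕ (step s)  (end zq)  = step (gapless-⊕-isZero s zq)
gapless-⊕ (step s)  (step t)  = step (gapless-⊕ s t)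

gapless-⊕-shiftN : ∀ j {e f p r} → j ≤ suc e → Gapless e p → Gapless f r →
                   Gapless (e ⊔ (j + f)) (p ⊕ shiftN j r)
gapless-⊕-shiftN zero          _         s        t = gapless-⊕ s t
gapless-⊕-shiftN (suc zero)    _         (end zp) t = step (isZero-⊕-gapless zp t)
gapless-⊕-shiftN (suc (suc j)) (s≤s ())  (end zp) t
gapless-⊕-shiftN (suc j)       (s≤s j≤e) (step s) t = step (gapless-⊕-shiftN j j≤e s t)

isZero-shiftN : ∀ j {r} → IsZero r → IsZero (shiftN j r)
isZero-shiftN zero    z = z
isZero-shiftN (suc j) z = refl ∷ isZero-shiftN j z

isZero-· : ∀ c {p} → IsZero p → IsZero (c · p)
isZero-· c []         = []
isZero-· c (refl ∷ z) = *-zeroʳ c ∷ isZero-· c z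

zero-·-isZero : ∀ p → IsZero (0 · p)
zero-·-isZero []      = []
zero-·-isZero (_ ∷ p) = refl ∷ zero-·-isZero p

gapless-· : ∀ c {d p} → Gapless d p → Gapless d (suc c · p)
gapless-· c (end z)  = end (isZero-· (suc c) z)
gapless-· c (step s) = step (gapless-· c s)

isZero-⊗ : ∀ {p} q → IsZero p → IsZero (p ⊗ q)
isZero-⊗ q []         = []
isZero-⊗ q (refl ∷ z) = isZero-⊕ (zero-·-isZero q) (refl ∷ isZero-⊗ q z)

gapless-⊗ : ∀ {d e p q} → Gapless d p → Gapless e q → Gapless (d + e) (p ⊗ q)
gapless-⊗ {q = q} (end {a} z) t = gapless-⊕-isZero (gapless-· a t) (refl ∷ isZero-⊗ q z)
gapless-⊗ {suc d} {e} (step {a} s) t =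
  gapless-degree (m≤n⇒m⊔n≡n (m≤n+m e (suc d)))
    (gapless-⊕-shiftN 1 (s≤s z≤n) (gapless-· a t) (gapless-⊗ s t))

qbinom-isZero : ∀ {n k} → n < k → IsZero (qbinom n k)
qbinom-isZero {zero}  {suc k} _         = []
qbinom-isZero {suc n} {suc k} (s≤s n<k) =
  isZero-⊕ (qbinom-isZero n<k) (isZero-shiftN (suc k) (qbinom-isZero (m<n⇒m<1+n n<k)))

qbinom-gapless : ∀ k m → Gapless (k * m) (qbinom (k + m) k)
qbinom-gapless zero    m       = end []
qbinom-gapless (suc k) zero    =
  gapless-⊕-isZero (qbinom-gapless k 0)
    (isZero-shiftN (suc k) (qbinom-isZero (s≤s (≤-reflexive (+-identityʳ k)))))
qbinom-gapless (suc k) (suc m) =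
  gapless-degree degree
    (gapless-⊕-shiftN (suc k) (s≤s (m≤m*n k (suc m)))
      (qbinom-gapless k (suc m))
      (subst (λ n → Gapless (suc k * m) (qbinom n (suc k))) (sym (+-suc k m)) (qbinom-gapless (suc k) m)))
  where
  degree : k * suc m ⊔ (suc k + suc k * m) ≡ suc k * suc m
  degree = begin
    k * suc m ⊔ (suc k + suc k * m)  ≡⟨ cong (k * suc m ⊔_) (sym (*-suc (suc k) m)) ⟩
    k * suc m ⊔ suc k * suc m        ≡⟨ m≤n⇒m⊔n≡n (m≤n+m (k * suc m) (suc m)) ⟩
    suc k * suc m                    ∎
    where open ≡-Reasoning

qbinom-gapless-≤ : ∀ {n k} → k ≤ n → Gapless (k * (n ∸ k)) (qbinom n k)
qbinom-gapless-≤ {n} {k} k≤n =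
  subst (λ m → Gapless (k * (n ∸ k)) (qbinom m k)) (m+[n∸m]≡n k≤n) (qbinom-gapless k (n ∸ k))

maxRange : (ℕ → ℕ) → ℕ → ℕ → ℕ
maxRange f k zero    = f k
maxRange f k (suc r) = f k ⊔ maxRange f (suc k) r

maxRange-suc : ∀ f k r → maxRange f k (suc r) ≡ maxRange f k r ⊔ f (suc (k + r))
maxRange-suc f k zero    = cong (λ i → f k ⊔ f (suc i)) (sym (+-identityʳ k))
maxRange-suc f k (suc r) = begin
  f k ⊔ maxRange f (suc k) (suc r)                     ≡⟨ cong (f k ⊔_) (maxRange-suc f (suc k) r) ⟩
  f k ⊔ (maxRange f (suc k) r ⊔ f (suc (suc k + r)))   ≡⟨ ⊔-assoc (f k) _ _ ⟨
  f k ⊔ maxRange f (suc k) r ⊔ f (suc (suc k + r))     ≡⟨ cong (λ i → f k ⊔ maxRange f (suc k) r ⊔ f (suc i)) (+-suc k r) ⟨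
  f k ⊔ maxRange f (suc k) r ⊔ f (suc (k + suc r))     ∎
  where open ≡-Reasoning

data GaplessRun (d : ℕ → ℕ) : ℕ → ℕ → List Poly → Set where
  [_] : ∀ {k b} → Gapless (d k) b → GaplessRun d k 0 (b ∷ [])
  _∷_ : ∀ {k r b bs} → Gapless (d k) b → GaplessRun d (suc k) r bs → GaplessRun d k (suc r) (b ∷ bs)

gaplessRun-∷ʳ : ∀ {d k r bs x} → GaplessRun d k r bs → Gapless (d (suc (k + r))) x →
                GaplessRun d k (suc r) (bs ∷ʳ x)
gaplessRun-∷ʳ {d} {k} [ s ] t = s ∷ [ gapless-degree (cong (d ∘ suc) (+-identityʳ k)) t ]
gaplessRun-∷ʳ {d} {k} {suc r} (s ∷ ss) t =
  s ∷ gaplessRun-∷ʳ ss (gapless-degree (cong (d ∘ suc) (+-suc k r)) t)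

gaplessRun-last : ∀ {d k r bs} z → GaplessRun d k r bs → Gapless (d (k + r)) (last z bs)
gaplessRun-last {d} {k} z [ s ] = gapless-degree (cong d (sym (+-identityʳ k))) s
gaplessRun-last {d} {k} {suc r} z (s ∷ ss) =
  gapless-degree (cong d (sym (+-suc k r))) (gaplessRun-last _ ss)

sumTerms-gapless : ∀ {n d k r bs} → GaplessRun d k r bs → k + r ≤ n →
                   Gapless (maxRange (λ j → j * (n ∸ j) + d j) k r) (sumTerms n k bs)
sumTerms-gapless {k = k} [ s ] k+0≤n =
  gapless-⊕-isZero (gapless-⊗ (qbinom-gapless-≤ (≤-trans (m≤m+n k 0) k+0≤n)) s) []
sumTerms-gapless {k = k} {suc r} (s ∷ ss) k+r+1≤n =
  gapless-⊕ (gapless-⊗ (qbinom-gapless-≤ (≤-trans (m≤m+n k (suc r)) k+r+1≤n)) s)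
            (sumTerms-gapless ss (≤-trans (≤-reflexive (sym (+-suc k r))) k+r+1≤n))

mutual
  -- appendLast is local to allB and has no name outside it; abstracting
  -- its arguments below lets unification solve for it.
  appendLast : ℕ → List Poly → Poly → List Poly
  appendLast = _

  allB-suc-unfold : ∀ n → allB (suc n) ≡ appendLast n (allB n) (sumTerms n 0 (allB n))
  allB-suc-unfold n with allB n | sumTerms n 0 (allB n)
  ... | bs | b = refl

appendLast≡∷ʳ : ∀ n bs b → appendLast n bs b ≡ bs ∷ʳ b
appendLast≡∷ʳ n []       b = refl
appendLast≡∷ʳ n (x ∷ bs) b = cong (x ∷_) (appendLast≡∷ʳ n bs b)

allB-suc : ∀ n → allB (suc n) ≡ allB n ∷ʳ sumTerms n 0 (allB n)
allB-suc n = trans (allB-suc-unfold n) (appendLast≡∷ʳ n _ _)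

maxOver-revG : ∀ {n} i m → i + m ≡ n →
               maxOver (suc n) (suc i) (revG m) ≡ maxRange (λ j → j * (n ∸ j) + g j) 0 m
maxOver-revG i zero refl = begin
  i * (i + 0 ∸ i) + 0 ⊔ 0  ≡⟨ ⊔-identityʳ _ ⟩
  i * (i + 0 ∸ i) + 0      ≡⟨ +-identityʳ _ ⟩
  i * (i + 0 ∸ i)          ≡⟨ cong (i *_) (m+n∸m≡n i 0) ⟩
  i * 0                    ≡⟨ *-zeroʳ i ⟩
  0                        ∎
  where open ≡-Reasoning
maxOver-revG i (suc m) refl = begin
  i * (n ∸ i) + g (suc m) ⊔ maxOver (suc n) (suc (suc i)) (revG m)
    ≡⟨ cong₂ _⊔_ (cong (_+ g (suc m)) weight) (maxOver-revG (suc i) m (sym (+-suc i m))) ⟩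
  f (suc m) ⊔ maxRange f 0 m  ≡⟨ ⊔-comm (f (suc m)) _ ⟩
  maxRange f 0 m ⊔ f (suc m)  ≡⟨ maxRange-suc f 0 m ⟨
  maxRange f 0 (suc m)        ∎
  where
  open ≡-Reasoning
  n : ℕ
  n = i + suc m
  f : ℕ → ℕ
  f j = j * (n ∸ j) + g j
  weight : i * (n ∸ i) ≡ suc m * (n ∸ suc m)
  weight = begin
    i * (n ∸ i)            ≡⟨ cong (i *_) (m+n∸m≡n i (suc m)) ⟩
    i * suc m              ≡⟨ *-comm i (suc m) ⟩
    suc m * i              ≡⟨ cong (suc m *_) (m+n∸n≡m i (suc m)) ⟨
    suc m * (n ∸ suc m)    ∎

g-suc : ∀ n → g (suc n) ≡ maxRange (λ j → j * (n ∸ j) + g j) 0 n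
g-suc n = maxOver-revG 0 n refl

allB-gaplessRun : ∀ n → GaplessRun g 0 n (allB n)
allB-gaplessRun zero    = [ end [] ]
allB-gaplessRun (suc n) rewrite allB-suc n =
  gaplessRun-∷ʳ (allB-gaplessRun n)
    (gapless-degree (sym (g-suc n)) (sumTerms-gapless (allB-gaplessRun n) ≤-refl))

qBell-gapless : ∀ n → Gapless (g n) (qBell n)
qBell-gapless n = gaplessRun-last [] (allB-gaplessRun n)

lemma5p4 : (n : ℕ) → nonzeroCount (qBell n) ≡ suc (g n)
lemma5p4 n = nonzeroCount-gapless (qBell-gapless n)
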